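{- Every canonical queue behavior has a sequential witness.
   Context: A queue event is a tuple $(u,m,d_{in},d_{out})$ with a globally unique identifier $u$ and method $m\in\{\mathtt{enq},\mathtt{deq}\}$; an enqueue event of value $x\in\mathbb{N}$ is written $\mathtt{enq}(x)$ and a dequeue event returning $x\in\mathbb{N}\cup\{\mathtt{NULL}\}$ is written $\mathtt{deq}(x)$. A queue behavior is a finite duplicate-free sequence of queue events. A behavior is canonical if it has the form $\big((\mathtt{deq}(\mathtt{NULL}))^*\cdot\mathtt{enq}(x)\cdot\mathtt{deq}(x)\big)^*\cdot(\mathtt{deq}(\mathtt{NULL}))^*\cdot(\mathtt{enq}(x))^*$, where in each pair $\mathtt{enq}(x)\cdot\mathtt{deq}(x)$ both events carry the same value $x\in\mathbb{N}$. For a behavior $b$: $\mathrm{Enq}(b)$, $\mathrm{Deq}(b)$ are its enqueue and dequeue events, $\mathrm{Val}(b,e)$ is the value enqueued or returned by $e$, and $e\prec_b e'$ means $e$ occurs before $e'$ in $b$. A sequential witness for $b$ is a total map $\mu:\mathrm{Deq}(b)\to\mathrm{Enq}(b)\cup\{\bot\}$ such that: (i) $\mu(d)=e$ implies $\mathrm{Val}(b,d)=\mathrm{Val}(b,e)$; (ii) $\mu(d)=\bot$ iff $\mathrm{Val}(b,d)=\mathtt{NULL}$; (iii) $\mu(d)=\mu(d')\neq\bot$ implies $d=d'$; (iv) $\mu(d)=e$ implies $e\prec_b d$; (v) if $e\prec_b\mu(d')$ then there is $d$ with $\mu(d)=e$ and $d\prec_b d'$; (vi) $\mu(d)=\bot$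 implies $|\{e\in\mathrm{Enq}(b)\mid e\prec_b d\}|=|\{d'\in\mathrm{Deq}(b)\mid d'\prec_b d,\ \mu(d')\neq\bot\}|$. -}

module Defs where

open import Data.Nat using (ℕ)
open import Data.Bool using (Bool; true; false)
open import Data.Maybe using (Maybe; just; nothing)
open import Data.Product using (Σ; ∃; _×_; _,_; proj₁; proj₂)
open import Data.List using (List; []; _∷_; _++_; map; concat; replicate; length; filter; lookup)
open import Data.Fin using (Fin; _<_; _<?_)
open import Data.Fin.Base using ()
open import Data.List using (allFin)
open import Data.List.Relation.Unary.AllPairs using (AllPairs)
open import Relation.Binary.PropositionalEquality using (_≡_; _≢_)
open import Relation.Nullary using (¬_; Dec; yes; no)
open import Relation.Nullary.Decidable using (_×-dec_; ¬?)
open import Data.Bool.Properties using () renaming (_≟_ to _≟B_)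
open import Data.Maybe.Properties using () renaming (≡-dec to ≡-decM)

-- The method together with its data: enq(x) carries the enqueued value x;
-- deq(r) carries the returned value r, where nothing represents NULL.
data Op : Set where
  enq : ℕ → Op
  deq : Maybe ℕ → Op

record Event : Set where
  constructor event
  field
    uid : ℕ
    op  : Op
open Event public

record Behavior : Set where
  constructor behavior
  field
    events : List Event
    unique : AllPairs (λ e e′ → uid e ≢ uid e′) events
open Behavior public

-- Events of b are identified with their positions in b.
Pos : Behavior → Set
Pos b = Fin (length (events b))

opAt : (b : Behavior) → Pos b → Op
opAt b i = op (lookup (events b) i)

isEnqOp : Op → Bool
isEnqOp (enq _) = true
isEnqOp (deq _) = false

IsEnq : (b : Behavior) → Pos b → Set
IsEnq b i = isEnqOp (opAt b i) ≡ true

IsDeq : (b : Behavior) → Pos b → Set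
IsDeq b i = isEnqOp (opAt b i) ≡ false

isEnq? : (b : Behavior) → (i : Pos b) → Dec (IsEnq b i)
isEnq? b i = isEnqOp (opAt b i) ≟B true

isDeq? : (b : Behavior) → (i : Pos b) → Dec (IsDeq b i)
isDeq? b i = isEnqOp (opAt b i) ≟B false

valOp : Op → Maybe ℕ
valOp (enq x) = just x
valOp (deq r) = r

Val : (b : Behavior) → Pos b → Maybe ℕ
Val b i = valOp (opAt b i)

-- Canonical behaviors:
--   ((deq(NULL))^* · enq(x) · deq(x))^* · (deq(NULL))^* · (enq(x))^*
deqNull : Op
deqNull = deq nothing

pairBlock : ℕ × ℕ → List Op
pairBlock (k , x) = replicate k deqNull ++ (enq x ∷ deq (just x) ∷ [])

CanonicalOps : List Op → Set
CanonicalOps os =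
  Σ (List (ℕ × ℕ)) λ ps → Σ ℕ λ m → Σ (List ℕ) λ xs →
    os ≡ concat (map pairBlock ps) ++ (replicate m deqNull ++ map enq xs)

Canonical : Behavior → Set
Canonical b = CanonicalOps (map op (events b))

enqBefore : (b : Behavior) → Pos b → ℕ
enqBefore b d = length (filter (λ e → isEnq? b e ×-dec (e <? d)) (allFin _))

matchedDeqBefore : (b : Behavior) → (Pos b → Maybe (Pos b)) → Pos b → ℕ
matchedDeqBefore b μ d =
  length (filter (λ d′ → isDeq? b d′ ×-dec ((d′ <? d) ×-dec ¬? (≡-decM Data.Fin._≟_ (μ d′) nothing)))
                 (allFin _))

-- A sequential witness.  μ : Deq(b) → Enq(b) ∪ {⊥} is represented by a
-- function on all positions whose values on non-dequeue positions are
-- irrelevant (no condition mentions them); `just e` must be an enqueue.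
record SequentialWitness (b : Behavior) (μ : Pos b → Maybe (Pos b)) : Set where
  field
    into-Enq : ∀ d e → IsDeq b d → μ d ≡ just e → IsEnq b e
    cond-i   : ∀ d e → IsDeq b d → μ d ≡ just e → Val b d ≡ Val b e
    cond-ii₁ : ∀ d → IsDeq b d → μ d ≡ nothing → Val b d ≡ nothing
    cond-ii₂ : ∀ d → IsDeq b d → Val b d ≡ nothing → μ d ≡ nothing
    cond-iii : ∀ d d′ e → IsDeq b d → IsDeq b d′ →
               μ d ≡ just e → μ d′ ≡ just e → d ≡ d′
    cond-iv  : ∀ d e → IsDeq b d → μ d ≡ just e → e < d
    cond-v   : ∀ d′ e e′ → IsDeq b d′ → IsEnq b e → μ d′ ≡ just e′ → e < e′ →
               Σ (Pos b) λ d → IsDeq b d × μ d ≡ just e × d < d′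
    cond-vi  : ∀ d → IsDeq b d → μ d ≡ nothing →
               enqBefore b d ≡ matchedDeqBefore b μ d

HasSequentialWitness : Behavior → Set
HasSequentialWitness b = Σ (Pos b → Maybe (Pos b)) (SequentialWitness b)

-- In a canonical behavior every non-null dequeue immediately follows the
-- enqueue of its value, so matching each such dequeue with its predecessor is
-- a sequential witness. The witness conditions reduce to three facts about the
-- list of operations (AdjacentlyMatched), and each of them is preserved when a
-- canonical word is extended on the left by deq(NULL) or by enq(x) · deq(x).
module Submission where

open import Defs
open import Agda.Builtin.Nat using () renaming (_<_ to _<ᵇ_)
open import Data.Bool using (Bool; true; false; _∧_; if_then_else_)
open import Data.Bool.Properties using (∧-zeroʳ; ∧-identityʳ) renaming (_≟_ to _≟B_)
open import Data.Empty using (⊥-elim)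
open import Data.Fin as Fin using (Fin; toℕ; fromℕ<; _<?_)
open import Data.Fin.Properties using (toℕ-injective; toℕ-fromℕ<; toℕ-inject₁)
open import Data.List using (List; []; _∷_; _++_; map; concat; replicate; length; filter; lookup; take; tabulate)
open import Data.List.Properties using (++-assoc; length-map)
open import Data.Maybe using (Maybe; just; nothing)
open import Data.Maybe.Properties using (just-injective) renaming (≡-dec to ≡-decM)
open import Data.Nat as ℕ using (ℕ; zero; suc; z≤n; s≤s)
open import Data.Nat.Properties using (≤-reflexive; ≤-trans; <-trans; ≤-<-trans)
open import Data.Product using (Σ; ∃-syntax; _×_; _,_)
open import Relation.Binary.PropositionalEquality
open import Relation.Nullary using (Dec; does)
open import Relation.Nullary.Decidable using (_×-dec_; ¬?)

private variable
  A B : Set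

lookup? : List A → ℕ → Maybe A
lookup? []       _       = nothing
lookup? (x ∷ xs) zero    = just x
lookup? (x ∷ xs) (suc k) = lookup? xs k

lookup?-map : (f : A → B) (xs : List A) (i : Fin (length xs)) →
              lookup? (map f xs) (toℕ i) ≡ just (f (lookup xs i))
lookup?-map f (x ∷ xs) Fin.zero    = refl
lookup?-map f (x ∷ xs) (Fin.suc i) = lookup?-map f xs i

lookup?-length : (xs : List A) (k : ℕ) {x : A} → lookup? xs k ≡ just x → k ℕ.< length xs
lookup?-length (_ ∷ xs) zero    _ = s≤s z≤n
lookup?-length (_ ∷ xs) (suc k) h = s≤s (lookup?-length xs k h)

count : (A → Bool) → List A → ℕ
count p []       = 0
count p (x ∷ xs) = if p x then suc (count p xs) else count p xs

-- Stated with the builtin test _<ᵇ_ because `does (i <? d)` computes to `toℕ i <ᵇ toℕ d`.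
length-filter-tabulate :
  (g : A → B) (p : B → Bool) (xs : List A) (k : ℕ)
  {m : ℕ} {Q : Fin m → Set} (Q? : (j : Fin m) → Dec (Q j)) (f : Fin (length xs) → Fin m) →
  (∀ i → does (Q? (f i)) ≡ p (g (lookup xs i)) ∧ (toℕ i <ᵇ k)) →
  length (filter Q? (tabulate f)) ≡ count p (take k (map g xs))
length-filter-tabulate g p []       zero    Q? f _ = refl
length-filter-tabulate g p []       (suc k) Q? f _ = refl
length-filter-tabulate g p (x ∷ xs) zero    Q? f hyp
  rewrite trans (hyp Fin.zero) (∧-zeroʳ (p (g x))) =
  length-filter-tabulate g p xs zero Q? (λ i → f (Fin.suc i)) (λ i → hyp (Fin.suc i))
length-filter-tabulate g p (x ∷ xs) (suc k) Q? f hyp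
  rewrite trans (hyp Fin.zero) (∧-identityʳ (p (g x))) with p (g x)
... | true  = cong suc (length-filter-tabulate g p xs k Q? (λ i → f (Fin.suc i)) (λ i → hyp (Fin.suc i)))
... | false = length-filter-tabulate g p xs k Q? (λ i → f (Fin.suc i)) (λ i → hyp (Fin.suc i))

toℕ-pred : ∀ {n} (i : Fin n) → toℕ (Fin.pred i) ≡ ℕ.pred (toℕ i)
toℕ-pred Fin.zero    = refl
toℕ-pred (Fin.suc i) = toℕ-inject₁ i

isMatchedDeqOp : Op → Bool
isMatchedDeqOp (deq (just _)) = true
isMatchedDeqOp _              = false

record AdjacentlyMatched (os : List Op) : Set where
  field
    enq-before-deq   : ∀ j x → lookup? os j ≡ just (deq (just x)) →
                       ∃[ i ] j ≡ suc i × lookup? os i ≡ just (enq x)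
    deq-after-enq    : ∀ i j x y → lookup? os i ≡ just (enq x) → lookup? os j ≡ just (deq (just y)) →
                       i ℕ.< j → ∃[ z ] lookup? os (suc i) ≡ just (deq (just z))
    balanced-at-null : ∀ k → lookup? os k ≡ just deqNull →
                       count isEnqOp (take k os) ≡ count isMatchedDeqOp (take k os)
open AdjacentlyMatched

lookup?-map-enq : ∀ xs j {r} → lookup? (map enq xs) j ≢ just (deq r)
lookup?-map-enq (_ ∷ xs) zero    ()
lookup?-map-enq (_ ∷ xs) (suc j) h = lookup?-map-enq xs j h

adjacentlyMatched-enqs : ∀ xs → AdjacentlyMatched (map enq xs)
adjacentlyMatched-enqs xs .enq-before-deq   j x h       = ⊥-elim (lookup?-map-enq xs j h)
adjacentlyMatched-enqs xs .deq-after-enq    i j x y _ h = ⊥-elim (lookup?-map-enq xs j h)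
adjacentlyMatched-enqs xs .balanced-at-null k h         = ⊥-elim (lookup?-map-enq xs k h)

adjacentlyMatched-deqNull∷ : ∀ {os} → AdjacentlyMatched os → AdjacentlyMatched (deqNull ∷ os)
adjacentlyMatched-deqNull∷ am .enq-before-deq (suc j) x h with am .enq-before-deq j x h
... | i , refl , hi = suc i , refl , hi
adjacentlyMatched-deqNull∷ am .deq-after-enq (suc i) (suc j) x y hi hj (s≤s i<j) =
  am .deq-after-enq i j x y hi hj i<j
adjacentlyMatched-deqNull∷ am .balanced-at-null zero    h = refl
adjacentlyMatched-deqNull∷ am .balanced-at-null (suc k) h = am .balanced-at-null k h

adjacentlyMatched-pair∷ : ∀ x {os} → AdjacentlyMatched os →
                          AdjacentlyMatched (enq x ∷ deq (just x) ∷ os)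
adjacentlyMatched-pair∷ x am .enq-before-deq (suc zero) _ refl = zero , refl , refl
adjacentlyMatched-pair∷ x am .enq-before-deq (suc (suc j)) y h with am .enq-before-deq j y h
... | i , refl , hi = suc (suc i) , refl , hi
adjacentlyMatched-pair∷ x am .deq-after-enq zero j _ _ _ _ _ = x , refl
adjacentlyMatched-pair∷ x am .deq-after-enq (suc (suc i)) (suc zero) _ _ _ _ (s≤s ())
adjacentlyMatched-pair∷ x am .deq-after-enq (suc (suc i)) (suc (suc j)) x′ y hi hj (s≤s (s≤s i<j)) =
  am .deq-after-enq i j x′ y hi hj i<j
adjacentlyMatched-pair∷ x am .balanced-at-null zero          h = refl
adjacentlyMatched-pair∷ x am .balanced-at-null (suc (suc k)) h = cong suc (am .balanced-at-null k h)

adjacentlyMatched-deqNulls++ : ∀ m {os} → AdjacentlyMatched os →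
                               AdjacentlyMatched (replicate m deqNull ++ os)
adjacentlyMatched-deqNulls++ zero    am = am
adjacentlyMatched-deqNulls++ (suc m) am = adjacentlyMatched-deqNull∷ (adjacentlyMatched-deqNulls++ m am)

adjacentlyMatched-pairBlocks++ : ∀ ps {os} → AdjacentlyMatched os →
                                 AdjacentlyMatched (concat (map pairBlock ps) ++ os)
adjacentlyMatched-pairBlocks++ []             am = am
adjacentlyMatched-pairBlocks++ ((k , x) ∷ ps) {os} am =
  subst AdjacentlyMatched (begin
      replicate k deqNull ++ (enq x ∷ deq (just x) ∷ []) ++ rest
    ≡⟨ ++-assoc (replicate k deqNull) _ rest ⟨
      pairBlock (k , x) ++ rest
    ≡⟨ ++-assoc (pairBlock (k , x)) _ os ⟨
      concat (map pairBlock ((k , x) ∷ ps)) ++ os ∎)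
    (adjacentlyMatched-deqNulls++ k (adjacentlyMatched-pair∷ x (adjacentlyMatched-pairBlocks++ ps am)))
  where
  open ≡-Reasoning
  rest : List Op
  rest = concat (map pairBlock ps) ++ os

canonical⇒adjacentlyMatched : ∀ {os} → CanonicalOps os → AdjacentlyMatched os
canonical⇒adjacentlyMatched (ps , m , xs , refl) =
  adjacentlyMatched-pairBlocks++ ps (adjacentlyMatched-deqNulls++ m (adjacentlyMatched-enqs xs))

matchPrev : ∀ {n} → Op → Fin n → Maybe (Fin n)
matchPrev (deq (just _)) d = just (Fin.pred d)
matchPrev _              _ = nothing

matchPrev-just : ∀ {n} o (d e : Fin n) → matchPrev o d ≡ just e →
                 ∃[ x ] o ≡ deq (just x) × e ≡ Fin.pred d
matchPrev-just (deq (just x)) d _ refl = x , refl , refl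

matchPrev-nothing : ∀ {n} o (d : Fin n) → isEnqOp o ≡ false → matchPrev o d ≡ nothing → o ≡ deqNull
matchPrev-nothing (deq nothing) d _ _ = refl

matchPrev-null : ∀ {n} o (d : Fin n) → valOp o ≡ nothing → matchPrev o d ≡ nothing
matchPrev-null (deq nothing) d _ = refl

isEnqOp-true : ∀ o → isEnqOp o ≡ true → ∃[ x ] o ≡ enq x
isEnqOp-true (enq x) _ = x , refl

adjacentMatch : (b : Behavior) → Pos b → Maybe (Pos b)
adjacentMatch b d = matchPrev (opAt b d) d

module AdjacentMatch (b : Behavior) (am : AdjacentlyMatched (map op (events b))) where

  os : List Op
  os = map op (events b)

  μ : Pos b → Maybe (Pos b)
  μ = adjacentMatch b

  lookup?-opAt : ∀ i {o} → opAt b i ≡ o → lookup? os (toℕ i) ≡ just o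
  lookup?-opAt i refl = lookup?-map op (events b) i

  opAt-lookup? : ∀ i {k o} → toℕ i ≡ k → lookup? os k ≡ just o → opAt b i ≡ o
  opAt-lookup? i refl h = just-injective (trans (sym (lookup?-opAt i refl)) h)

  lookup?⇒Pos : ∀ k {o} → lookup? os k ≡ just o → Σ (Pos b) λ i → toℕ i ≡ k × opAt b i ≡ o
  lookup?⇒Pos k h = fromℕ< k<n , toℕ-fromℕ< k<n , opAt-lookup? (fromℕ< k<n) (toℕ-fromℕ< k<n) h
    where
    k<n : k ℕ.< length (events b)
    k<n = subst (k ℕ.<_) (length-map op (events b)) (lookup?-length os k h)

  matched : ∀ d e → μ d ≡ just e →
            ∃[ x ] opAt b d ≡ deq (just x) × opAt b e ≡ enq x × toℕ d ≡ suc (toℕ e)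
  matched d e h with matchPrev-just (opAt b d) d e h
  ... | x , od , refl with am .enq-before-deq (toℕ d) x (lookup?-opAt d od)
  ... | i , d≡1+i , hi = x , od , opAt-lookup? (Fin.pred d) e≡i hi , trans d≡1+i (cong suc (sym e≡i))
    where
    e≡i : toℕ (Fin.pred d) ≡ i
    e≡i = trans (toℕ-pred d) (cong ℕ.pred d≡1+i)

  matchedDeqAt : ∀ d e {z} → opAt b d ≡ deq (just z) → toℕ d ≡ suc (toℕ e) → μ d ≡ just e
  matchedDeqAt d e od d≡1+e rewrite od =
    cong just (toℕ-injective (trans (toℕ-pred d) (cong ℕ.pred d≡1+e)))

  dequeuedNext : ∀ e d′ e′ → IsEnq b e → μ d′ ≡ just e′ → e Fin.< e′ →
                 Σ (Pos b) λ d → IsDeq b d × μ d ≡ just e × d Fin.< d′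
  dequeuedNext e d′ e′ isEnq h e<e′ with isEnqOp-true (opAt b e) isEnq | matched d′ e′ h
  ... | x , oe | y , od′ , _ , d′≡1+e′
    with am .deq-after-enq (toℕ e) (toℕ d′) x y (lookup?-opAt e oe) (lookup?-opAt d′ od′)
           (<-trans e<e′ (≤-reflexive (sym d′≡1+e′)))
  ... | z , hz with lookup?⇒Pos (suc (toℕ e)) hz
  ... | d , d≡1+e , od =
    d , cong isEnqOp od , matchedDeqAt d e od d≡1+e ,
    ≤-<-trans (≤-trans (≤-reflexive d≡1+e) e<e′) (≤-reflexive (sym d′≡1+e′))

  enqBefore-count : ∀ d → enqBefore b d ≡ count isEnqOp (take (toℕ d) os)
  enqBefore-count d =
    length-filter-tabulate op isEnqOp (events b) (toℕ d) _ (λ i → i)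
      (λ i → cong (_∧ (toℕ i <ᵇ toℕ d)) (does-isEnq? (opAt b i)))
    where
    does-isEnq? : ∀ o → does (isEnqOp o ≟B true) ≡ isEnqOp o
    does-isEnq? (enq _) = refl
    does-isEnq? (deq _) = refl

  matchedDeqBefore-count : ∀ d → matchedDeqBefore b μ d ≡ count isMatchedDeqOp (take (toℕ d) os)
  matchedDeqBefore-count d =
    length-filter-tabulate op isMatchedDeqOp (events b) (toℕ d) _ (λ i → i)
      (λ i → does-isMatched? (opAt b i) i (i <? d))
    where
    does-isMatched? : ∀ {P : Set} o i (P? : Dec P) →
      does ((isEnqOp o ≟B false) ×-dec (P? ×-dec ¬? (≡-decM Fin._≟_ (matchPrev o i) nothing)))
        ≡ isMatchedDeqOp o ∧ does P?
    does-isMatched? (enq _)        i P? = refl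
    does-isMatched? (deq nothing)  i P? = ∧-zeroʳ (does P?)
    does-isMatched? (deq (just _)) i P? = ∧-identityʳ (does P?)

  witness : SequentialWitness b μ
  witness = record
    { into-Enq = λ d e _ h → let (_ , _ , oe , _) = matched d e h in cong isEnqOp oe
    ; cond-i   = λ d e _ h → let (_ , od , oe , _) = matched d e h in trans (cong valOp od) (sym (cong valOp oe))
    ; cond-ii₁ = λ d isDeq h → cong valOp (matchPrev-nothing (opAt b d) d isDeq h)
    ; cond-ii₂ = λ d _ h → matchPrev-null (opAt b d) d h
    ; cond-iii = λ d d′ e _ _ h h′ →
        let (_ , _ , _ , d≡1+e) = matched d e h ; (_ , _ , _ , d′≡1+e) = matched d′ e h′
        in toℕ-injective (trans d≡1+e (sym d′≡1+e))
    ; cond-iv  = λ d e _ h → let (_ , _ , _ , d≡1+e) = matched d e h in ≤-reflexive (sym d≡1+e)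
    ; cond-v   = λ d′ e e′ _ → dequeuedNext e d′ e′
    ; cond-vi  = λ d isDeq h → begin
        enqBefore b d                                 ≡⟨ enqBefore-count d ⟩
        count isEnqOp (take (toℕ d) os)               ≡⟨ am .balanced-at-null (toℕ d) (lookup?-opAt d (matchPrev-nothing (opAt b d) d isDeq h)) ⟩
        count isMatchedDeqOp (take (toℕ d) os)        ≡⟨ matchedDeqBefore-count d ⟨
        matchedDeqBefore b μ d                        ∎
    }
    where open ≡-Reasoning

lemma3p3 : (b : Behavior) → Canonical b → HasSequentialWitness b
lemma3p3 b canonical = adjacentMatch b , AdjacentMatch.witness b (canonical⇒adjacentlyMatched canonical)
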